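{- Let $\mathcal L$ be a differential summable resource category with differentiation $\partial$, and let $\mathcal L_!$ be its Kleisli category. Define $D:\mathcal L_!\to\mathcal L_!$ by $DX=SX$ and $Df=(Sf)\circ\partial_X\in\mathcal L(!SX,SY)$ for $f\in\mathcal L(!X,Y)$, and set $\eta^D_X=\iota_{0,X}\circ\mathrm{der}_X\in\mathcal L_!(X,DX)$ and $\mu^D_X=\mu_X\circ\mathrm{der}_{S^2X}\in\mathcal L_!(D^2X,DX)$. Then $\eta^D$ and $\mu^D$ are natural transformations (on $\mathcal L_!$) and $(D,\eta^D,\mu^D)$ is a monad on $\mathcal L_!$.
   Context: A resource category is a symmetric monoidal category $(\mathcal L,\otimes,1)$, enriched over pointed sets (distinguished zero morphisms absorbing for composition and tensor), which is cartesian (terminal $\top$, products $X_0\& X_1$, projections $\mathrm{pr}_i$) and has a comonad $(!,\mathrm{der},\mathrm{dig})$ with Seely isomorphisms $m^0:1\to!\top$, $m^2_{X,Y}:!X\otimes!Y\to!(X\& Y)$ satisfying the usual Seely-category axioms. Its Kleisli category $\mathcal L_!$ has $\mathcal L_!(X,Y)=\mathcal L(!X,Y)$, composition $g\bullet f=g\circ!f\circ\mathrm{dig}_X$ and identities $\mathrm{der}_X$. A summability structure $(S,\pi_0,\pi_1,\sigma)$ on $\mathcal L$: $S$ an endofunctor with $S0=0$, $\pi_0,\pi_1,\sigma:S\Rightarrow\mathrm{Id}$ natural, $\pi_0,\pi_1$ jointly monic; $f_0,f_1\in\mathcal L(X,Y)$ are summable if there is a (unique) $\langle f_0,f_1\rangle_S\in\mathcal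 L(X,SY)$ with $\pi_i\langle f_0,f_1\rangle_S=f_i$, and $f_0+f_1=\sigma\langle f_0,f_1\rangle_S$; axioms (S-com) $\pi_1,\pi_0$ summable, $\sigma\langle\pi_1,\pi_0\rangle_S=\sigma$; (S-zero) $f,0$ summable with $f+0=f$; (S-witness) if $(f_{00},f_{01}),(f_{10},f_{11})$ and $(f_{00}+f_{01},f_{10}+f_{11})$ are summable, so are $\langle f_{00},f_{01}\rangle_S,\langle f_{10},f_{11}\rangle_S$; (S-assoc) $S\sigma_X\circ c_X=\sigma_{SX}$, where $c_X$ is the unique endomorphism of $S^2X$ with $\pi_{i,X}\pi_{j,SX}c_X=\pi_{j,X}\pi_{i,SX}$. Summable resource category: moreover (S-dist) if $f_{00},f_{01}$ summable then $f_{00}\otimes f_1,f_{01}\otimes f_1$ summable with sum $(f_{00}+f_{01})\otimes f_1$; (S-prod) $S$ preserves finite products. Notation: $\iota_{0,X}=\langle\mathrm{id},0\rangle_S$; $\mu_X=\langle\pi_{0,X}\pi_{0,SX},\pi_{1,X}\pi_{0,SX}+\pi_{0,X}\pi_{1,SX}\rangle_S\in\mathcal L(S^2X,SX)$; $\mathsf m_{X_0,X_1}=\langle\pi_0\otimes\pi_0,\pi_1\otimes\pi_0+\pi_0\otimes\pi_1\rangle_S$. A differentiation is a natural transformation $\partial_X\in\mathcal L(!SX,S!X)$ such that: (D-local) $\pi_0\circ\partial_X=!\pi_{0,X}$; (D-lin) $\partial_X\circ!\iota_{0,X}=\iota_{0,!X}$ and $\mu_{!X}\circ S\partial_X\circ\partial_{SX}=\partial_X\circ!\mu_X$;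 (D-chain) $S(\mathrm{der}_X)\circ\partial_X=\mathrm{der}_{SX}$ and $S(\mathrm{dig}_X)\circ\partial_X=\partial_{!X}\circ!\partial_X\circ\mathrm{dig}_{SX}$; (D-with) $S((m^0)^{ -1})\circ\partial_\top=\iota_{0,1}\circ(m^0)^{ -1}\circ!0$ and $S((m^2_{X_0,X_1})^{ -1})\circ\partial_{X_0\& X_1}=\mathsf m_{!X_0,!X_1}\circ(\partial_{X_0}\otimes\partial_{X_1})\circ(m^2_{SX_0,SX_1})^{ -1}\circ!\langle S\mathrm{pr}_0,S\mathrm{pr}_1\rangle$; (D-schwarz) $c_{!X}\circ S\partial_X\circ\partial_{SX}=S\partial_X\circ\partial_{SX}\circ!c_X$. A differential summable resource category is a summable resource category equipped with a differentiation (which makes $D$ a functor on $\mathcal L_!$). -}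

module Defs where

open import Level using (Level; _⊔_) renaming (suc to lsuc)
open import Data.Product using (Σ; _×_; _,_; proj₁; proj₂)
open import Relation.Binary.PropositionalEquality using (_≡_)

record ResourceCategory (o h : Level) : Set (lsuc (o ⊔ h)) where
  infixr 9 _∘_
  infixr 10 _⊗₁_
  infixr 11 _⊗₀_
  infixr 12 _&_
  field
    Obj : Set o
    _⇒_ : Obj → Obj → Set h
    id  : ∀ {X} → X ⇒ X
    _∘_ : ∀ {X Y Z} → Y ⇒ Z → X ⇒ Y → X ⇒ Z
    identityˡ : ∀ {X Y} (f : X ⇒ Y) → id ∘ f ≡ f
    identityʳ : ∀ {X Y} (f : X ⇒ Y) → f ∘ id ≡ f
    assoc : ∀ {W X Y Z} (h : Y ⇒ Z) (g : X ⇒ Y) (f : W ⇒ X) →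
            (h ∘ g) ∘ f ≡ h ∘ (g ∘ f)

    -- enrichment over pointed sets: zero morphisms
    0m : ∀ {X Y} → X ⇒ Y
    zero-∘ˡ : ∀ {X Y Z} (f : X ⇒ Y) → 0m {Y} {Z} ∘ f ≡ 0m
    zero-∘ʳ : ∀ {X Y Z} (g : Y ⇒ Z) → g ∘ 0m {X} {Y} ≡ 0m

    _⊗₀_ : Obj → Obj → Obj
    _⊗₁_ : ∀ {X Y X' Y'} → X ⇒ Y → X' ⇒ Y' → (X ⊗₀ X') ⇒ (Y ⊗₀ Y')
    ⊗-id : ∀ {X Y} → id {X} ⊗₁ id {Y} ≡ id
    ⊗-∘  : ∀ {X Y Z X' Y' Z'} (f : Y ⇒ Z) (g : X ⇒ Y) (f' : Y' ⇒ Z') (g' : X' ⇒ Y') →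
           (f ∘ g) ⊗₁ (f' ∘ g') ≡ (f ⊗₁ f') ∘ (g ⊗₁ g')
    zero-⊗ˡ : ∀ {X Y X' Y'} (f : X' ⇒ Y') → 0m {X} {Y} ⊗₁ f ≡ 0m
    zero-⊗ʳ : ∀ {X Y X' Y'} (f : X ⇒ Y) → f ⊗₁ 0m {X'} {Y'} ≡ 0m
    𝟙 : Obj
    α   : ∀ {X Y Z} → ((X ⊗₀ Y) ⊗₀ Z) ⇒ (X ⊗₀ (Y ⊗₀ Z))
    α⁻¹ : ∀ {X Y Z} → (X ⊗₀ (Y ⊗₀ Z)) ⇒ ((X ⊗₀ Y) ⊗₀ Z)
    α-iso₁ : ∀ {X Y Z} → α⁻¹ ∘ α {X} {Y} {Z} ≡ id
    α-iso₂ : ∀ {X Y Z} → α {X} {Y} {Z} ∘ α⁻¹ ≡ id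
    α-nat : ∀ {X Y Z X' Y' Z'} (f : X ⇒ X') (g : Y ⇒ Y') (k : Z ⇒ Z') →
            α ∘ ((f ⊗₁ g) ⊗₁ k) ≡ (f ⊗₁ (g ⊗₁ k)) ∘ α
    λ⇒ : ∀ {X} → (𝟙 ⊗₀ X) ⇒ X
    λ⇐ : ∀ {X} → X ⇒ (𝟙 ⊗₀ X)
    λ-iso₁ : ∀ {X} → λ⇐ ∘ λ⇒ {X} ≡ id
    λ-iso₂ : ∀ {X} → λ⇒ {X} ∘ λ⇐ ≡ id
    λ-nat : ∀ {X Y} (f : X ⇒ Y) → λ⇒ ∘ (id ⊗₁ f) ≡ f ∘ λ⇒
    ρ⇒ : ∀ {X} → (X ⊗₀ 𝟙) ⇒ X
    ρ⇐ : ∀ {X} → X ⇒ (X ⊗₀ 𝟙)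
    ρ-iso₁ : ∀ {X} → ρ⇐ ∘ ρ⇒ {X} ≡ id
    ρ-iso₂ : ∀ {X} → ρ⇒ {X} ∘ ρ⇐ ≡ id
    ρ-nat : ∀ {X Y} (f : X ⇒ Y) → ρ⇒ ∘ (f ⊗₁ id) ≡ f ∘ ρ⇒
    γ : ∀ {X Y} → (X ⊗₀ Y) ⇒ (Y ⊗₀ X)
    γ-nat : ∀ {X Y X' Y'} (f : X ⇒ X') (g : Y ⇒ Y') → γ ∘ (f ⊗₁ g) ≡ (g ⊗₁ f) ∘ γ
    γ-invol : ∀ {X Y} → γ {Y} {X} ∘ γ {X} {Y} ≡ id
    pentagon : ∀ {W X Y Z} →
      (id {W} ⊗₁ α {X} {Y} {Z}) ∘ α ∘ (α ⊗₁ id) ≡ α ∘ α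
    triangle : ∀ {X Y} → (id {X} ⊗₁ λ⇒ {Y}) ∘ α ≡ ρ⇒ ⊗₁ id
    hexagon : ∀ {X Y Z} →
      α ∘ γ {X} {Y ⊗₀ Z} ∘ α ≡ (id ⊗₁ γ) ∘ α ∘ (γ ⊗₁ id)

    ⊤ : Obj
    ⟨⟩ : ∀ {X} → X ⇒ ⊤
    ⟨⟩-unique : ∀ {X} (f : X ⇒ ⊤) → f ≡ ⟨⟩
    _&_ : Obj → Obj → Obj
    pr₀ : ∀ {X Y} → (X & Y) ⇒ X
    pr₁ : ∀ {X Y} → (X & Y) ⇒ Y
    ⟨_,_⟩ : ∀ {Z X Y} → Z ⇒ X → Z ⇒ Y → Z ⇒ (X & Y)
    pr₀-⟨⟩ : ∀ {Z X Y} (f : Z ⇒ X) (g : Z ⇒ Y) → pr₀ ∘ ⟨ f , g ⟩ ≡ f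
    pr₁-⟨⟩ : ∀ {Z X Y} (f : Z ⇒ X) (g : Z ⇒ Y) → pr₁ ∘ ⟨ f , g ⟩ ≡ g
    ⟨⟩-unique₂ : ∀ {Z X Y} (f : Z ⇒ X) (g : Z ⇒ Y) (k : Z ⇒ (X & Y)) →
                 pr₀ ∘ k ≡ f → pr₁ ∘ k ≡ g → k ≡ ⟨ f , g ⟩

    !₀ : Obj → Obj
    !₁ : ∀ {X Y} → X ⇒ Y → !₀ X ⇒ !₀ Y
    !-id : ∀ {X} → !₁ (id {X}) ≡ id
    !-∘  : ∀ {X Y Z} (g : Y ⇒ Z) (f : X ⇒ Y) → !₁ (g ∘ f) ≡ !₁ g ∘ !₁ f
    der : ∀ {X} → !₀ X ⇒ X
    dig : ∀ {X} → !₀ X ⇒ !₀ (!₀ X)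
    der-nat : ∀ {X Y} (f : X ⇒ Y) → der ∘ !₁ f ≡ f ∘ der
    dig-nat : ∀ {X Y} (f : X ⇒ Y) → dig ∘ !₁ f ≡ !₁ (!₁ f) ∘ dig
    comonad-idˡ : ∀ {X} → der ∘ dig {X} ≡ id
    comonad-idʳ : ∀ {X} → !₁ der ∘ dig {X} ≡ id
    comonad-assoc : ∀ {X} → dig ∘ dig {X} ≡ !₁ dig ∘ dig

    m⁰ : 𝟙 ⇒ !₀ ⊤
    m⁰⁻¹ : !₀ ⊤ ⇒ 𝟙
    m⁰-iso₁ : m⁰⁻¹ ∘ m⁰ ≡ id
    m⁰-iso₂ : m⁰ ∘ m⁰⁻¹ ≡ id
    m² : ∀ {X Y} → (!₀ X ⊗₀ !₀ Y) ⇒ !₀ (X & Y)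
    m²⁻¹ : ∀ {X Y} → !₀ (X & Y) ⇒ (!₀ X ⊗₀ !₀ Y)
    m²-iso₁ : ∀ {X Y} → m²⁻¹ ∘ m² {X} {Y} ≡ id
    m²-iso₂ : ∀ {X Y} → m² {X} {Y} ∘ m²⁻¹ ≡ id
    m²-nat : ∀ {X Y X' Y'} (f : X ⇒ X') (g : Y ⇒ Y') →
             m² ∘ (!₁ f ⊗₁ !₁ g) ≡ !₁ ⟨ f ∘ pr₀ , g ∘ pr₁ ⟩ ∘ m²
    -- (!, m⁰, m²) is a symmetric monoidal functor (L,&,⊤) → (L,⊗,𝟙)
    m-assoc : ∀ {X Y Z} →
      m² {X} {Y & Z} ∘ (id ⊗₁ m² {Y} {Z}) ∘ α
        ≡ !₁ ⟨ pr₀ ∘ pr₀ , ⟨ pr₁ ∘ pr₀ , pr₁ ⟩ ⟩ ∘ m² {X & Y} {Z} ∘ (m² ⊗₁ id)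
    m-unitˡ : ∀ {X} → !₁ pr₁ ∘ m² {⊤} {X} ∘ (m⁰ ⊗₁ id) ≡ λ⇒
    m-unitʳ : ∀ {X} → !₁ pr₀ ∘ m² {X} {⊤} ∘ (id ⊗₁ m⁰) ≡ ρ⇒
    m-sym : ∀ {X Y} → m² {Y} {X} ∘ γ ≡ !₁ ⟨ pr₁ , pr₀ ⟩ ∘ m² {X} {Y}
    m-dig : ∀ {X Y} →
      m² { !₀ X} { !₀ Y} ∘ (dig ⊗₁ dig) ≡ !₁ ⟨ !₁ pr₀ , !₁ pr₁ ⟩ ∘ dig ∘ m² {X} {Y}

module Summ {o h : Level} (L : ResourceCategory o h) where
  open ResourceCategory L

  IsIso : ∀ {X Y} → X ⇒ Y → Set h
  IsIso {X} {Y} f = Σ (Y ⇒ X) λ g → (g ∘ f ≡ id) × (f ∘ g ≡ id)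

  record SummableStructure : Set (o ⊔ h) where
    field
      S₀ : Obj → Obj
      S₁ : ∀ {X Y} → X ⇒ Y → S₀ X ⇒ S₀ Y
      S-id : ∀ {X} → S₁ (id {X}) ≡ id
      S-∘  : ∀ {X Y Z} (g : Y ⇒ Z) (f : X ⇒ Y) → S₁ (g ∘ f) ≡ S₁ g ∘ S₁ f
      S-0  : ∀ {X Y} → S₁ (0m {X} {Y}) ≡ 0m
      π₀ : ∀ {X} → S₀ X ⇒ X
      π₁ : ∀ {X} → S₀ X ⇒ X
      σ  : ∀ {X} → S₀ X ⇒ X
      π₀-nat : ∀ {X Y} (f : X ⇒ Y) → π₀ ∘ S₁ f ≡ f ∘ π₀
      π₁-nat : ∀ {X Y} (f : X ⇒ Y) → π₁ ∘ S₁ f ≡ f ∘ π₁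
      σ-nat  : ∀ {X Y} (f : X ⇒ Y) → σ ∘ S₁ f ≡ f ∘ σ
      π-jointly-monic : ∀ {X Y} (f g : X ⇒ S₀ Y) →
        π₀ ∘ f ≡ π₀ ∘ g → π₁ ∘ f ≡ π₁ ∘ g → f ≡ g

    Summable : ∀ {X Y} → X ⇒ Y → X ⇒ Y → Set h
    Summable {X} {Y} f₀ f₁ = Σ (X ⇒ S₀ Y) λ w → (π₀ ∘ w ≡ f₀) × (π₁ ∘ w ≡ f₁)

    sum : ∀ {X Y} {f₀ f₁ : X ⇒ Y} → Summable f₀ f₁ → X ⇒ Y
    sum s = σ ∘ proj₁ s

    field
      S-com : ∀ {X} → Σ (Summable (π₁ {X}) π₀) λ s → sum s ≡ σ
      S-zero : ∀ {X Y} (f : X ⇒ Y) → Σ (Summable f 0m) λ s → sum s ≡ f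
      S-witness : ∀ {X Y} {f₀₀ f₀₁ f₁₀ f₁₁ : X ⇒ Y}
        (s₀ : Summable f₀₀ f₀₁) (s₁ : Summable f₁₀ f₁₁) →
        Summable (sum s₀) (sum s₁) → Summable (proj₁ s₀) (proj₁ s₁)
      -- c_X : the unique endomorphism of S²X with π_i π_j c = π_j π_i
      -- (its existence is a consequence of the axioms; uniqueness follows
      -- from joint monicity)
      c : ∀ {X} → S₀ (S₀ X) ⇒ S₀ (S₀ X)
      c-00 : ∀ {X} → π₀ {X} ∘ π₀ ∘ c ≡ π₀ ∘ π₀
      c-01 : ∀ {X} → π₀ {X} ∘ π₁ ∘ c ≡ π₁ ∘ π₀
      c-10 : ∀ {X} → π₁ {X} ∘ π₀ ∘ c ≡ π₀ ∘ π₁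
      c-11 : ∀ {X} → π₁ {X} ∘ π₁ ∘ c ≡ π₁ ∘ π₁
      S-assoc : ∀ {X} → S₁ (σ {X}) ∘ c ≡ σ {S₀ X}
      S-dist : ∀ {X Y X' Y'} {f₀₀ f₀₁ : X ⇒ Y} (f₁ : X' ⇒ Y') (s : Summable f₀₀ f₀₁) →
        Σ (Summable (f₀₀ ⊗₁ f₁) (f₀₁ ⊗₁ f₁)) λ t → sum t ≡ sum s ⊗₁ f₁
      S-prod-⊤ : IsIso (⟨⟩ {S₀ ⊤})
      S-prod-& : ∀ {X Y} → IsIso (⟨ S₁ (pr₀ {X} {Y}) , S₁ pr₁ ⟩)
      -- μ_X = ⟨π₀π₀ , π₁π₀ + π₀π₁⟩_S  (π_{i,X} π_{j,SX}); the summability of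
      -- π₁π₀, π₀π₁ and of the resulting pair is a lemma of the theory
      μ : ∀ {X} → S₀ (S₀ X) ⇒ S₀ X
      μ-sum : ∀ {X} → Summable (π₁ {X} ∘ π₀) (π₀ ∘ π₁)
      μ-π₀ : ∀ {X} → π₀ ∘ μ {X} ≡ π₀ ∘ π₀
      μ-π₁ : ∀ {X} → π₁ ∘ μ {X} ≡ sum μ-sum
      𝗆 : ∀ {X₀ X₁} → (S₀ X₀ ⊗₀ S₀ X₁) ⇒ S₀ (X₀ ⊗₀ X₁)
      𝗆-sum : ∀ {X₀ X₁} → Summable (π₁ {X₀} ⊗₁ π₀ {X₁}) (π₀ ⊗₁ π₁)
      𝗆-π₀ : ∀ {X₀ X₁} → π₀ ∘ 𝗆 {X₀} {X₁} ≡ π₀ ⊗₁ π₀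
      𝗆-π₁ : ∀ {X₀ X₁} → π₁ ∘ 𝗆 {X₀} {X₁} ≡ sum 𝗆-sum

    ι₀ : ∀ {X} → X ⇒ S₀ X
    ι₀ = proj₁ (proj₁ (S-zero id))

module Diff {o h : Level} (L : ResourceCategory o h)
            (SS : Summ.SummableStructure L) where
  open ResourceCategory L
  open Summ.SummableStructure SS

  record Differentiation : Set (o ⊔ h) where
    field
      ∂ : ∀ {X} → !₀ (S₀ X) ⇒ S₀ (!₀ X)
      ∂-nat : ∀ {X Y} (f : X ⇒ Y) → ∂ ∘ !₁ (S₁ f) ≡ S₁ (!₁ f) ∘ ∂
      D-local : ∀ {X} → π₀ ∘ ∂ {X} ≡ !₁ π₀
      D-lin₁ : ∀ {X} → ∂ {X} ∘ !₁ ι₀ ≡ ι₀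
      D-lin₂ : ∀ {X} → μ ∘ S₁ ∂ ∘ ∂ {S₀ X} ≡ ∂ ∘ !₁ μ
      D-chain₁ : ∀ {X} → S₁ der ∘ ∂ {X} ≡ der
      D-chain₂ : ∀ {X} → S₁ dig ∘ ∂ {X} ≡ ∂ ∘ !₁ ∂ ∘ dig
      D-with₀ : S₁ m⁰⁻¹ ∘ ∂ {⊤} ≡ ι₀ ∘ m⁰⁻¹ ∘ !₁ (0m {S₀ ⊤} {⊤})
      D-with₂ : ∀ {X₀ X₁} →
        S₁ m²⁻¹ ∘ ∂ {X₀ & X₁}
          ≡ 𝗆 ∘ (∂ ⊗₁ ∂) ∘ m²⁻¹ ∘ !₁ ⟨ S₁ pr₀ , S₁ pr₁ ⟩
      D-schwarz : ∀ {X} → c ∘ S₁ ∂ ∘ ∂ {S₀ X} ≡ S₁ ∂ ∘ ∂ ∘ !₁ c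

  _•_ : ∀ {X Y Z} → !₀ Y ⇒ Z → !₀ X ⇒ Y → !₀ X ⇒ Z
  g • f = g ∘ !₁ f ∘ dig

  module WithDiff (δ : Differentiation) where
    open Differentiation δ

    D₀ : Obj → Obj
    D₀ = S₀

    D₁ : ∀ {X Y} → !₀ X ⇒ Y → !₀ (D₀ X) ⇒ D₀ Y
    D₁ f = S₁ f ∘ ∂

    ηᴰ : ∀ {X} → !₀ X ⇒ D₀ X
    ηᴰ = ι₀ ∘ der

    μᴰ : ∀ {X} → !₀ (D₀ (D₀ X)) ⇒ D₀ X
    μᴰ = μ ∘ der

    record KleisliMonad : Set (o ⊔ h) where
      field
        D-identity : ∀ {X} → D₁ (der {X}) ≡ der
        D-homomorphism : ∀ {X Y Z} (g : !₀ Y ⇒ Z) (f : !₀ X ⇒ Y) →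
          D₁ (g • f) ≡ D₁ g • D₁ f
        ηᴰ-natural : ∀ {X Y} (f : !₀ X ⇒ Y) → D₁ f • ηᴰ ≡ ηᴰ • f
        μᴰ-natural : ∀ {X Y} (f : !₀ X ⇒ Y) → D₁ f • μᴰ ≡ μᴰ • D₁ (D₁ f)
        unit-left  : ∀ {X} → μᴰ • D₁ (ηᴰ {X}) ≡ der
        unit-right : ∀ {X} → μᴰ • ηᴰ {D₀ X} ≡ der
        monad-assoc : ∀ {X} → μᴰ • D₁ (μᴰ {X}) ≡ μᴰ • μᴰ {D₀ X}

{-# OPTIONS --safe #-}

-- The summability structure alone makes (S, ι₀, μ) a monad on L: by joint
-- monicity of π₀ and π₁ its laws reduce to the unit, commutativity and
-- associativity laws of partial sums, the last one coming from S-witness and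
-- S-assoc. D-chain makes D a functor on L_!, D-lin says exactly that the
-- Kleisli liftings ι₀ ∘ der and μ ∘ der are natural for D, and the monad laws
-- of ηᴰ and μᴰ are the liftings of those of (S, ι₀, μ).
module Submission where

open import Level using (Level)
open import Data.Product using (Σ; _,_; proj₁; proj₂)
open import Relation.Binary.PropositionalEquality
open import Defs

module MorphismReasoning {o h : Level} (L : ResourceCategory o h) where
  open ResourceCategory L

  pullˡ : ∀ {W X Y Z} {a : Y ⇒ Z} {b : X ⇒ Y} {c : X ⇒ Z} {f : W ⇒ X} →
          a ∘ b ≡ c → a ∘ (b ∘ f) ≡ c ∘ f
  pullˡ {a = a} {b} {f = f} e = trans (sym (assoc a b f)) (cong (_∘ f) e)

  extendˡ : ∀ {W X Y Y' Z} {a : Y ⇒ Z} {b : X ⇒ Y} {c : Y' ⇒ Z} {d : X ⇒ Y'}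
            {f : W ⇒ X} → a ∘ b ≡ c ∘ d → a ∘ (b ∘ f) ≡ c ∘ (d ∘ f)
  extendˡ {c = c} {d} {f} e = trans (pullˡ e) (assoc c d f)

  extend₃ˡ : ∀ {V W X Y Y' Z} {a : Y ⇒ Z} {b : X ⇒ Y} {c : W ⇒ X} {d : Y' ⇒ Z}
             {e : W ⇒ Y'} {f : V ⇒ W} →
             a ∘ (b ∘ c) ≡ d ∘ e → a ∘ (b ∘ (c ∘ f)) ≡ d ∘ (e ∘ f)
  extend₃ˡ {a = a} {b} {c} {f = f} p =
    trans (cong (a ∘_) (sym (assoc b c f))) (extendˡ p)

module Kleisli {o h : Level} (L : ResourceCategory o h) where
  open ResourceCategory L
  open MorphismReasoning L

  •-identityˡ : ∀ {X Y} (f : !₀ X ⇒ Y) → der ∘ (!₁ f ∘ dig) ≡ f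
  •-identityˡ f =
    trans (extendˡ (der-nat f)) (trans (cong (f ∘_) comonad-idˡ) (identityʳ f))

  !₁-∘der-dig : ∀ {X Y} (b : X ⇒ Y) → !₁ (b ∘ der) ∘ dig ≡ !₁ b
  !₁-∘der-dig b =
    trans (cong (_∘ dig) (!-∘ b der))
          (trans (assoc _ _ _) (trans (cong (!₁ b ∘_) comonad-idʳ) (identityʳ _)))

  ∘der-• : ∀ {X Y Z} (b : Y ⇒ Z) (f : !₀ X ⇒ Y) → (b ∘ der) ∘ (!₁ f ∘ dig) ≡ b ∘ f
  ∘der-• b f = trans (assoc _ _ _) (cong (b ∘_) (•-identityˡ f))

module Summation {o h : Level} (L : ResourceCategory o h)
                 (SS : Summ.SummableStructure L) where
  open ResourceCategory L
  open Summ.SummableStructure SS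
  open MorphismReasoning L
  open ≡-Reasoning

  Summable-cong : ∀ {X Y} {f₀ f₁ g₀ g₁ : X ⇒ Y} →
                  f₀ ≡ g₀ → f₁ ≡ g₁ → Summable f₀ f₁ → Summable g₀ g₁
  Summable-cong e₀ e₁ (u , p₀ , p₁) = u , trans p₀ e₀ , trans p₁ e₁

  sum-cong : ∀ {X Y} {f₀ f₁ g₀ g₁ : X ⇒ Y} (s : Summable f₀ f₁) (t : Summable g₀ g₁) →
             f₀ ≡ g₀ → f₁ ≡ g₁ → sum s ≡ sum t
  sum-cong (u , p₀ , p₁) (v , q₀ , q₁) e₀ e₁ =
    cong (σ ∘_) (π-jointly-monic u v (trans p₀ (trans e₀ (sym q₀)))
                                     (trans p₁ (trans e₁ (sym q₁))))

  +-identityʳ : ∀ {X Y} {f : X ⇒ Y} (s : Summable f 0m) → sum s ≡ f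
  +-identityʳ {f = f} s = trans (sum-cong s (proj₁ (S-zero f)) refl refl) (proj₂ (S-zero f))

  +-comm : ∀ {X Y} {f₀ f₁ : X ⇒ Y} (s : Summable f₀ f₁) →
           Σ (Summable f₁ f₀) λ t → sum t ≡ sum s
  +-comm (u , p₀ , p₁) =
    (swap ∘ u , trans (pullˡ swap-π₀) p₁ , trans (pullˡ swap-π₁) p₀) , pullˡ (proj₂ S-com)
    where
      swap = proj₁ (proj₁ S-com)
      swap-π₀ = proj₁ (proj₂ (proj₁ S-com))
      swap-π₁ = proj₂ (proj₂ (proj₁ S-com))

  +-identityˡ : ∀ {X Y} {f : X ⇒ Y} (s : Summable 0m f) → sum s ≡ f
  +-identityˡ s = trans (sym (proj₂ (+-comm s))) (+-identityʳ (proj₁ (+-comm s)))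

  ∘-distribˡ-+ : ∀ {X Y Z} {f₀ f₁ : X ⇒ Y} (g : Y ⇒ Z) (s : Summable f₀ f₁) →
                 Σ (Summable (g ∘ f₀) (g ∘ f₁)) λ t → sum t ≡ g ∘ sum s
  ∘-distribˡ-+ g (u , p₀ , p₁) =
    ( S₁ g ∘ u
    , trans (extendˡ (π₀-nat g)) (cong (g ∘_) p₀)
    , trans (extendˡ (π₁-nat g)) (cong (g ∘_) p₁))
    , extendˡ (σ-nat g)

  σ-σ-c : ∀ {X} → σ ∘ (σ ∘ c) ≡ σ {X} ∘ σ
  σ-σ-c = begin
    σ ∘ (σ ∘ c)        ≡⟨ sym (extendˡ (σ-nat σ)) ⟩
    σ ∘ (S₁ σ ∘ c)     ≡⟨ cong (σ ∘_) S-assoc ⟩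
    σ ∘ σ              ∎

  -- Writing d as d + 0, S-witness gives a witness of the matrix ((a , b) , (d , 0));
  -- c transposes it into ((a , d) , (b , 0)), and S-assoc says σ ∘ σ does not notice.
  +-exchange : ∀ {X Y} {a b d : X ⇒ Y} (s : Summable a b) (t : Summable (sum s) d) →
               Σ (Summable a d) λ s' → Σ (Summable (sum s') b) λ t' → sum t ≡ sum t'
  +-exchange {X} {Y} {a} {b} {d} s@(u , u₀ , u₁) t = s' , t' , sum-t≡sum-t'
    where
      z : Summable d 0m
      z = proj₁ (S-zero d)
      W : Summable u (proj₁ z)
      W = S-witness s z (Summable-cong refl (sym (proj₂ (S-zero d))) t)
      W₀ = proj₁ (proj₂ W)
      W₁ = proj₂ (proj₂ W)
      V : X ⇒ S₀ (S₀ Y)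
      V = c ∘ proj₁ W
      s' : Summable a d
      s' = π₀ ∘ V
         , trans (extend₃ˡ c-00) (trans (cong (π₀ ∘_) W₀) u₀)
         , trans (extend₃ˡ c-10) (trans (cong (π₀ ∘_) W₁) (proj₁ (proj₂ z)))
      π₁V : Summable b 0m
      π₁V = π₁ ∘ V
          , trans (extend₃ˡ c-01) (trans (cong (π₁ ∘_) W₀) u₁)
          , trans (extend₃ˡ c-11) (trans (cong (π₁ ∘_) W₁) (proj₂ (proj₂ z)))
      σV = ∘-distribˡ-+ σ (V , refl , refl)
      t' : Summable (sum s') b
      t' = Summable-cong refl (+-identityʳ π₁V) (proj₁ σV)
      σW = ∘-distribˡ-+ σ W
      sum-t≡sum-t' : sum t ≡ sum t'
      sum-t≡sum-t' = begin
        sum t              ≡⟨ sum-cong t (proj₁ σW) refl (sym (proj₂ (S-zero d))) ⟩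
        sum (proj₁ σW)     ≡⟨ proj₂ σW ⟩
        σ ∘ (σ ∘ proj₁ W)  ≡⟨ sym (extend₃ˡ σ-σ-c) ⟩
        σ ∘ (σ ∘ V)        ≡⟨ sym (proj₂ σV) ⟩
        sum t'             ∎

  +-assoc : ∀ {X Y} {a b d : X ⇒ Y} (sab : Summable a b) (sbd : Summable b d)
            (s₁ : Summable (sum sab) d) (s₂ : Summable a (sum sbd)) → sum s₁ ≡ sum s₂
  +-assoc sab sbd s₁ s₂ with +-comm s₂
  ... | s₂' , sum-s₂' with +-exchange sbd s₂'
  ...   | sba , t , sum-t with +-comm sba
  ...     | sab' , sum-sab' = begin
    sum s₁   ≡⟨ sum-cong s₁ t (trans (sum-cong sab sab' refl refl) sum-sab') refl ⟩
    sum t    ≡⟨ sym sum-t ⟩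
    sum s₂'  ≡⟨ sum-s₂' ⟩
    sum s₂   ∎

  ι₀-π₀ : ∀ {X} → π₀ ∘ ι₀ {X} ≡ id
  ι₀-π₀ = proj₁ (proj₂ (proj₁ (S-zero id)))

  ι₀-π₁ : ∀ {X} → π₁ ∘ ι₀ {X} ≡ 0m
  ι₀-π₁ = proj₂ (proj₂ (proj₁ (S-zero id)))

  ι₀-natural : ∀ {X Y} (f : X ⇒ Y) → S₁ f ∘ ι₀ ≡ ι₀ ∘ f
  ι₀-natural f = π-jointly-monic _ _
    (trans (extendˡ (π₀-nat f)) (trans (cong (f ∘_) ι₀-π₀)
      (trans (identityʳ f) (sym (trans (pullˡ ι₀-π₀) (identityˡ f))))))
    (trans (extendˡ (π₁-nat f)) (trans (cong (f ∘_) ι₀-π₁)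
      (trans (zero-∘ʳ f) (sym (trans (pullˡ ι₀-π₁) (zero-∘ˡ f))))))

  μ-summand : ∀ {X Y} (k : X ⇒ S₀ (S₀ Y)) → Summable (π₁ ∘ (π₀ ∘ k)) (π₀ ∘ (π₁ ∘ k))
  μ-summand k = proj₁ μ-sum ∘ k
              , trans (pullˡ (proj₁ (proj₂ μ-sum))) (assoc _ _ _)
              , trans (pullˡ (proj₂ (proj₂ μ-sum))) (assoc _ _ _)

  π₀-μ : ∀ {X Y} (k : X ⇒ S₀ (S₀ Y)) → π₀ ∘ (μ ∘ k) ≡ π₀ ∘ (π₀ ∘ k)
  π₀-μ k = trans (pullˡ μ-π₀) (assoc _ _ _)

  π₁-μ : ∀ {X Y} (k : X ⇒ S₀ (S₀ Y)) → π₁ ∘ (μ ∘ k) ≡ sum (μ-summand k)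
  π₁-μ k = trans (pullˡ μ-π₁) (assoc _ _ _)

  μ-natural : ∀ {X Y} (f : X ⇒ Y) → μ ∘ S₁ (S₁ f) ≡ S₁ f ∘ μ
  μ-natural f = π-jointly-monic _ _
    (begin
      π₀ ∘ (μ ∘ S₁ (S₁ f))   ≡⟨ π₀-μ _ ⟩
      π₀ ∘ (π₀ ∘ S₁ (S₁ f))  ≡⟨ cong (π₀ ∘_) (π₀-nat (S₁ f)) ⟩
      π₀ ∘ (S₁ f ∘ π₀)       ≡⟨ extendˡ (π₀-nat f) ⟩
      f ∘ (π₀ ∘ π₀)          ≡⟨ cong (f ∘_) (sym μ-π₀) ⟩
      f ∘ (π₀ ∘ μ)           ≡⟨ sym (extendˡ (π₀-nat f)) ⟩
      π₀ ∘ (S₁ f ∘ μ)        ∎)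
    (begin
      π₁ ∘ (μ ∘ S₁ (S₁ f))          ≡⟨ π₁-μ _ ⟩
      sum (μ-summand (S₁ (S₁ f)))   ≡⟨ sum-cong (μ-summand _) (proj₁ fμ)
                                         (trans (cong (π₁ ∘_) (π₀-nat (S₁ f))) (extendˡ (π₁-nat f)))
                                         (trans (cong (π₀ ∘_) (π₁-nat (S₁ f))) (extendˡ (π₀-nat f))) ⟩
      sum (proj₁ fμ)                ≡⟨ proj₂ fμ ⟩
      f ∘ sum μ-sum                 ≡⟨ cong (f ∘_) (sym μ-π₁) ⟩
      f ∘ (π₁ ∘ μ)                  ≡⟨ sym (extendˡ (π₁-nat f)) ⟩
      π₁ ∘ (S₁ f ∘ μ)               ∎)
    where fμ = ∘-distribˡ-+ f μ-sum

  μ-identityˡ : ∀ {X} → μ ∘ S₁ (ι₀ {X}) ≡ id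
  μ-identityˡ = π-jointly-monic _ _
    (begin
      π₀ ∘ (μ ∘ S₁ ι₀)   ≡⟨ π₀-μ _ ⟩
      π₀ ∘ (π₀ ∘ S₁ ι₀)  ≡⟨ cong (π₀ ∘_) (π₀-nat ι₀) ⟩
      π₀ ∘ (ι₀ ∘ π₀)     ≡⟨ trans (pullˡ ι₀-π₀) (identityˡ _) ⟩
      π₀                 ≡⟨ sym (identityʳ _) ⟩
      π₀ ∘ id            ∎)
    (begin
      π₁ ∘ (μ ∘ S₁ ι₀)            ≡⟨ π₁-μ _ ⟩
      sum (μ-summand (S₁ ι₀))     ≡⟨ +-identityˡ (Summable-cong
                                       (trans (cong (π₁ ∘_) (π₀-nat ι₀)) (trans (pullˡ ι₀-π₁) (zero-∘ˡ _)))
                                       (trans (cong (π₀ ∘_) (π₁-nat ι₀)) (trans (pullˡ ι₀-π₀) (identityˡ _)))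
                                       (μ-summand (S₁ ι₀))) ⟩
      π₁                          ≡⟨ sym (identityʳ _) ⟩
      π₁ ∘ id                     ∎)

  μ-identityʳ : ∀ {X} → μ ∘ ι₀ {S₀ X} ≡ id
  μ-identityʳ = π-jointly-monic _ _
    (begin
      π₀ ∘ (μ ∘ ι₀)   ≡⟨ π₀-μ _ ⟩
      π₀ ∘ (π₀ ∘ ι₀)  ≡⟨ cong (π₀ ∘_) ι₀-π₀ ⟩
      π₀ ∘ id         ∎)
    (begin
      π₁ ∘ (μ ∘ ι₀)          ≡⟨ π₁-μ _ ⟩
      sum (μ-summand ι₀)     ≡⟨ +-identityʳ (Summable-cong
                                  (trans (cong (π₁ ∘_) ι₀-π₀) (identityʳ _))
                                  (trans (cong (π₀ ∘_) ι₀-π₁) (zero-∘ʳ _))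
                                  (μ-summand ι₀)) ⟩
      π₁                     ≡⟨ sym (identityʳ _) ⟩
      π₁ ∘ id                ∎)

  -- On S³X both sides have first component π₀π₀π₀ and second component
  -- (π₁π₀π₀ + π₀π₁π₀) + π₀π₀π₁ and π₁π₀π₀ + (π₀π₁π₀ + π₀π₀π₁) respectively.
  μ-assoc : ∀ {X} → μ ∘ S₁ μ ≡ μ ∘ μ {S₀ X}
  μ-assoc {X} = π-jointly-monic _ _
    (begin
      π₀ ∘ (μ ∘ S₁ μ)   ≡⟨ π₀-μ _ ⟩
      π₀ ∘ (π₀ ∘ S₁ μ)  ≡⟨ cong (π₀ ∘_) (π₀-nat μ) ⟩
      π₀ ∘ (μ ∘ π₀)     ≡⟨ π₀-μ _ ⟩
      π₀ ∘ (π₀ ∘ π₀)    ≡⟨ cong (π₀ ∘_) (sym μ-π₀) ⟩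
      π₀ ∘ (π₀ ∘ μ)     ≡⟨ sym (π₀-μ _) ⟩
      π₀ ∘ (μ ∘ μ)      ∎)
    (begin
      π₁ ∘ (μ ∘ S₁ μ)   ≡⟨ π₁-μ _ ⟩
      sum s₁            ≡⟨ +-assoc sab (proj₁ sbd) s₁ s₂ ⟩
      sum s₂            ≡⟨ sym (π₁-μ _) ⟩
      π₁ ∘ (μ ∘ μ)      ∎)
    where
      sab = μ-summand π₀
      sbd = ∘-distribˡ-+ π₀ μ-sum
      s₁ : Summable (sum sab) (π₀ ∘ (π₀ ∘ π₁ {S₀ (S₀ X)}))
      s₁ = Summable-cong (trans (cong (π₁ ∘_) (π₀-nat μ)) (π₁-μ π₀))
                         (trans (cong (π₀ ∘_) (π₁-nat μ)) (π₀-μ π₁))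
                         (μ-summand (S₁ μ))
      s₂ : Summable (π₁ ∘ (π₀ ∘ π₀ {S₀ (S₀ X)})) (sum (proj₁ sbd))
      s₂ = Summable-cong (cong (π₁ ∘_) μ-π₀)
                         (trans (cong (π₀ ∘_) μ-π₁) (sym (proj₂ sbd)))
                         (μ-summand μ)

module KleisliDerivative {o h : Level} (L : ResourceCategory o h)
    (SS : Summ.SummableStructure L) (δ : Diff.Differentiation L SS) where
  open ResourceCategory L
  open Summ.SummableStructure SS
  open Diff L SS
  open Differentiation δ
  open WithDiff δ
  open MorphismReasoning L
  open Kleisli L
  open Summation L SS
  open ≡-Reasoning

  D₁-∘der : ∀ {X Y} (b : X ⇒ Y) → D₁ (b ∘ der) ≡ S₁ b ∘ der
  D₁-∘der b = trans (cong (_∘ ∂) (S-∘ b der)) (trans (assoc _ _ _) (cong (S₁ b ∘_) D-chain₁))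

  D₁-• : ∀ {X Y Z} (g : !₀ Y ⇒ Z) (f : !₀ X ⇒ Y) → D₁ (g • f) ≡ D₁ g • D₁ f
  D₁-• g f = begin
    S₁ (g ∘ (!₁ f ∘ dig)) ∘ ∂             ≡⟨ cong (_∘ ∂) (trans (S-∘ g _) (cong (S₁ g ∘_) (S-∘ (!₁ f) dig))) ⟩
    (S₁ g ∘ (S₁ (!₁ f) ∘ S₁ dig)) ∘ ∂     ≡⟨ trans (assoc _ _ _) (cong (S₁ g ∘_) (assoc _ _ _)) ⟩
    S₁ g ∘ (S₁ (!₁ f) ∘ (S₁ dig ∘ ∂))     ≡⟨ cong (λ k → S₁ g ∘ (S₁ (!₁ f) ∘ k)) D-chain₂ ⟩
    S₁ g ∘ (S₁ (!₁ f) ∘ (∂ ∘ (!₁ ∂ ∘ dig)))  ≡⟨ cong (S₁ g ∘_) (sym (extendˡ (∂-nat f))) ⟩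
    S₁ g ∘ (∂ ∘ (!₁ (S₁ f) ∘ (!₁ ∂ ∘ dig)))  ≡⟨ cong (λ k → S₁ g ∘ (∂ ∘ k))
                                                  (sym (trans (cong (_∘ dig) (!-∘ _ _)) (assoc _ _ _))) ⟩
    S₁ g ∘ (∂ ∘ (!₁ (S₁ f ∘ ∂) ∘ dig))   ≡⟨ sym (assoc _ _ _) ⟩
    (S₁ g ∘ ∂) ∘ (!₁ (S₁ f ∘ ∂) ∘ dig)   ∎

  ηᴰ-natural : ∀ {X Y} (f : !₀ X ⇒ Y) → D₁ f • ηᴰ ≡ ηᴰ • f
  ηᴰ-natural f = begin
    (S₁ f ∘ ∂) ∘ (!₁ (ι₀ ∘ der) ∘ dig)  ≡⟨ cong ((S₁ f ∘ ∂) ∘_) (!₁-∘der-dig ι₀) ⟩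
    (S₁ f ∘ ∂) ∘ !₁ ι₀                  ≡⟨ trans (assoc _ _ _) (cong (S₁ f ∘_) D-lin₁) ⟩
    S₁ f ∘ ι₀                           ≡⟨ ι₀-natural f ⟩
    ι₀ ∘ f                              ≡⟨ sym (∘der-• ι₀ f) ⟩
    (ι₀ ∘ der) ∘ (!₁ f ∘ dig)           ∎

  μᴰ-natural : ∀ {X Y} (f : !₀ X ⇒ Y) → D₁ f • μᴰ ≡ μᴰ • D₁ (D₁ f)
  μᴰ-natural f = begin
    (S₁ f ∘ ∂) ∘ (!₁ (μ ∘ der) ∘ dig)  ≡⟨ cong ((S₁ f ∘ ∂) ∘_) (!₁-∘der-dig μ) ⟩
    (S₁ f ∘ ∂) ∘ !₁ μ                  ≡⟨ trans (assoc _ _ _) (cong (S₁ f ∘_) (sym D-lin₂)) ⟩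
    S₁ f ∘ (μ ∘ (S₁ ∂ ∘ ∂))            ≡⟨ sym (extendˡ (μ-natural f)) ⟩
    μ ∘ (S₁ (S₁ f) ∘ (S₁ ∂ ∘ ∂))       ≡⟨ cong (μ ∘_) (sym (trans (cong (_∘ ∂) (S-∘ _ _)) (assoc _ _ _))) ⟩
    μ ∘ D₁ (D₁ f)                      ≡⟨ sym (∘der-• μ _) ⟩
    (μ ∘ der) ∘ (!₁ (D₁ (D₁ f)) ∘ dig) ∎

  μᴰ-identityˡ : ∀ {X} → μᴰ • D₁ (ηᴰ {X}) ≡ der
  μᴰ-identityˡ = begin
    (μ ∘ der) ∘ (!₁ (D₁ (ι₀ ∘ der)) ∘ dig)  ≡⟨ ∘der-• μ _ ⟩
    μ ∘ D₁ (ι₀ ∘ der)                       ≡⟨ cong (μ ∘_) (D₁-∘der ι₀) ⟩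
    μ ∘ (S₁ ι₀ ∘ der)                       ≡⟨ trans (pullˡ μ-identityˡ) (identityˡ _) ⟩
    der                                     ∎

  μᴰ-identityʳ : ∀ {X} → μᴰ • ηᴰ {D₀ X} ≡ der
  μᴰ-identityʳ = begin
    (μ ∘ der) ∘ (!₁ (ι₀ ∘ der) ∘ dig)  ≡⟨ ∘der-• μ _ ⟩
    μ ∘ (ι₀ ∘ der)                     ≡⟨ trans (pullˡ μ-identityʳ) (identityˡ _) ⟩
    der                                ∎

  μᴰ-assoc : ∀ {X} → μᴰ • D₁ (μᴰ {X}) ≡ μᴰ • μᴰ {D₀ X}
  μᴰ-assoc = begin
    (μ ∘ der) ∘ (!₁ (D₁ (μ ∘ der)) ∘ dig)  ≡⟨ ∘der-• μ _ ⟩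
    μ ∘ D₁ (μ ∘ der)                       ≡⟨ cong (μ ∘_) (D₁-∘der μ) ⟩
    μ ∘ (S₁ μ ∘ der)                       ≡⟨ extendˡ μ-assoc ⟩
    μ ∘ (μ ∘ der)                          ≡⟨ sym (∘der-• μ _) ⟩
    (μ ∘ der) ∘ (!₁ (μ ∘ der) ∘ dig)       ∎

mainTheorem7 : ∀ {o h : Level} (L : ResourceCategory o h)
    (SS : Summ.SummableStructure L) (δ : Diff.Differentiation L SS) →
    Diff.WithDiff.KleisliMonad L SS δ
mainTheorem7 L SS δ = record
  { D-identity     = D-chain₁
  ; D-homomorphism = D₁-•
  ; ηᴰ-natural     = ηᴰ-natural
  ; μᴰ-natural     = μᴰ-natural
  ; unit-left      = μᴰ-identityˡ
  ; unit-right     = μᴰ-identityʳ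
  ; monad-assoc    = μᴰ-assoc
  }
  where
    open Diff.Differentiation δ
    open KleisliDerivative L SS δ
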